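{- Let $j\in\{1,\ldots,k\}$ and let $S\in\Omega_{j-1}$ be normalized. Let $e(S)=\{X\in\Omega_j: X\,e\,S\}$. Then the orbits of $\mathrm{Aut}(S)$ on $e(S)$ are in one-to-one correspondence with the elements of $\bigl(u_j^{\mathrm{Aut}(U_{j-1})}/\mathrm{Aut}(S)\bigr)\times R$, where $u_j^{\mathrm{Aut}(U_{j-1})}/\mathrm{Aut}(S)$ denotes the set of orbits of $\mathrm{Aut}(S)$ on $u_j^{\mathrm{Aut}(U_{j-1})}$.
   Context: Let $U$, $R$ be finite sets and $\Gamma$ a finite group acting on $U$ from the right ($u^\gamma$, with $u^{\beta\gamma}=(u^\beta)^\gamma$), and on subsets $W\subseteq U$ elementwise. A partial assignment is a map $X:W\to R$ with $W\subseteq U$; write $\underline{X}=W$, and $X|_Q$ for the restriction to $Q\subseteq\underline{X}$. $\Gamma$ acts on partial assignments by $X^\gamma:W^\gamma\to R$, $X^\gamma(u)=X(u^{\gamma^{ -1}})$. For an object $Y$ acted on by $\Gamma$, $\mathrm{Aut}(Y)=\{\gamma\in\Gamma:Y^\gamma=Y\}$ and $Y^\Lambda=\{Y^\lambda:\lambda\in\Lambda\}$ for $\Lambda\le\Gamma$. Fix distinct $u_1,\ldots,u_k\in U$ and $U_j=\{u_1,\ldots,u_j\}$ ($U_0=\emptyset$). $\Omega_j$ is the set of partial assignments $X$ with $\underline{X}=U_j^\gamma$ for some $\gamma\in\Gamma$; $X\in\Omega_j$ is normalized if $\underline{X}=U_j$. For $X\in\Omega_j$, $S\in\Omega_{j-1}$,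 $X\,e\,S$ iff there exists $\gamma\in\Gamma$ with $\underline{X}^\gamma=U_j$, $\underline{S}^\gamma=U_{j-1}$, and $X^\gamma|_{U_{j-1}}=S^\gamma$. For normalized $S$ one has $\mathrm{Aut}(S)\le\mathrm{Aut}(U_{j-1})$, so $\mathrm{Aut}(S)$ acts on $u_j^{\mathrm{Aut}(U_{j-1})}$ and on $e(S)$. -}

module Defs where

open import Level using (Level; _⊔_; 0ℓ)
open import Algebra.Bundles using (Group)
open import Data.Nat using (ℕ; suc; _<_)
open import Data.Fin using (Fin; toℕ)
open import Data.Maybe using (Maybe; just; nothing)
open import Data.List using (List)
open import Data.List.Relation.Unary.Any using (Any)
open import Data.Product using (Σ; ∃; _×_; _,_; proj₁; proj₂)
open import Relation.Nullary using (¬_)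
open import Relation.Binary.PropositionalEquality using (_≡_)
open import Function.Definitions using (Injective)

record RightAction {c ℓ : Level} (G : Group c ℓ) (X : Set) : Set (c ⊔ ℓ) where
  open Group G
  field
    act    : X → Carrier → X
    act-ε  : ∀ x → act x ε ≡ x
    act-∙  : ∀ x β γ → act x (β ∙ γ) ≡ act (act x β) γ
    act-cong : ∀ x {β γ} → β ≈ γ → act x β ≡ act x γ

FiniteGroup : {c ℓ : Level} → Group c ℓ → Set (c ⊔ ℓ)
FiniteGroup G = Σ (List Carrier) λ xs → ∀ g → Any (g ≈_) xs
  where open Group G

-- The standing setting: U = Fin n, R = Fin m (arbitrary finite sets),
-- a finite group Γ acting on U from the right, distinct points u : Fin k → U
-- (u_{t+1} in the paper is  u t  here, 0-based).
record Setting (c ℓ : Level) : Set (Level.suc (c ⊔ ℓ)) where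
  field
    n m k  : ℕ
    Γ      : Group c ℓ
    Γ-fin  : FiniteGroup Γ
    action : RightAction Γ (Fin n)
    u      : Fin k → Fin n
    u-inj  : Injective _≡_ _≡_ u

module Theory {c ℓ : Level} (A : Setting c ℓ) where
  open Setting A public
  open Group Γ public using (Carrier; _⁻¹; _∙_; ε; _≈_)
  open RightAction action public

  U : Set
  U = Fin n

  R : Set
  R = Fin m

  Subset : Set₁
  Subset = U → Set

  _≐_ : Subset → Subset → Set
  P ≐ Q = ∀ x → (P x → Q x) × (Q x → P x)

  _^ˢ_ : Subset → Carrier → Subset
  (W ^ˢ γ) x = Σ U λ w → W w × act w γ ≡ x

  -- partial assignments X : W → R, represented as U → Maybe R
  PA : Set
  PA = U → Maybe R

  Dom : PA → Subset
  Dom X x = Σ R λ r → X x ≡ just r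

  _≗ₚ_ : PA → PA → Set
  X ≗ₚ Y = ∀ x → X x ≡ Y x

  _^ᵖ_ : PA → Carrier → PA
  (X ^ᵖ γ) x = X (act x (γ ⁻¹))

  IsRestriction : PA → Subset → PA → Set
  IsRestriction X Q Y =
    (∀ x → Q x → Dom X x) ×
    (∀ x → (Q x → Y x ≡ X x) × (¬ Q x → Y x ≡ nothing))

  Uset : ℕ → Subset
  Uset j x = Σ (Fin k) λ t → toℕ t < j × u t ≡ x

  InΩ : ℕ → PA → Set c
  InΩ j X = Σ Carrier λ γ → Dom X ≐ (Uset j ^ˢ γ)

  Normalized : ℕ → PA → Set
  Normalized j X = Dom X ≐ Uset j

  -- X e S  for X ∈ Ω_j, S ∈ Ω_{j-1}; here j = suc j'
  E : ℕ → PA → PA → Set c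
  E j' X S = Σ Carrier λ γ →
      ((Dom X ^ˢ γ) ≐ Uset (suc j')) ×
      ((Dom S ^ˢ γ) ≐ Uset j') ×
      IsRestriction (X ^ᵖ γ) (Uset j') (S ^ᵖ γ)

  AutPA : PA → Carrier → Set
  AutPA S γ = (S ^ᵖ γ) ≗ₚ S

  AutSet : Subset → Carrier → Set
  AutSet W γ = (W ^ˢ γ) ≐ W

  eS : ℕ → PA → Set c
  eS j' S = Σ PA λ X → InΩ (suc j') X × E j' X S

  SameOrbitE : (j' : ℕ) (S : PA) → eS j' S → eS j' S → Set c
  SameOrbitE j' S (X , _) (Y , _) = Σ Carrier λ σ → AutPA S σ × (X ^ᵖ σ) ≗ₚ Y

  -- the orbit u_j^{Aut(U_{j-1})}  (u_j = u i,  j-1 = toℕ i)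
  OrbU : Fin k → Set c
  OrbU i = Σ U λ v → Σ Carrier λ γ → AutSet (Uset (toℕ i)) γ × act (u i) γ ≡ v

  -- the relation on u_j^{Aut(U_{j-1})} × R whose classes are the elements of
  -- (u_j^{Aut(U_{j-1})} / Aut(S)) × R
  SameOrbitP : (i : Fin k) (S : PA) → OrbU i × R → OrbU i × R → Set c
  SameOrbitP i S ((v , _) , r) ((v' , _) , r') =
    (Σ Carrier λ σ → AutPA S σ × act v σ ≡ v') × r ≡ r'

  InducesBijection : {a b p q : Level} {X : Set a} {Y : Set b}
    (_~₁_ : X → X → Set p) (_~₂_ : Y → Y → Set q) (φ : X → Y) → Set (a ⊔ b ⊔ p ⊔ q)
  InducesBijection {X = X} {Y} _~₁_ _~₂_ φ =
    (∀ x y → x ~₁ y → φ x ~₂ φ y) ×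
    (∀ x y → φ x ~₂ φ y → x ~₁ y) ×
    (∀ z → Σ X λ x → φ x ~₂ z)

module Submission where

-- Write W = U_{j-1} = dom S.  The key observation is that every X ∈ e(S)
-- is a one-point extension  extend S w r  (S together with w ↦ r), where
-- w = u_j^g for some g ∈ Aut(W); conversely every such extension lies in
-- e(S).  An automorphism σ of S conjugates  extend S w r  into
-- extend S (w^σ) r, and a one-point extension determines its point and its
-- value.  Hence the map  X ↦ (w , r)  identifies the Aut(S)-orbits on e(S)
-- with the Aut(S)-orbits on u_j^{Aut(W)} times R.

open import Defs
open import Level using (Level)
open import Algebra.Bundles using (Group)
import Algebra.Properties.Group as GroupProperties
open import Data.Empty using (⊥-elim)
open import Data.Fin using (Fin; toℕ; _≟_)
open import Data.Fin.Properties using (toℕ-injective)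
open import Data.Maybe using (just; nothing)
open import Data.Maybe.Properties using (just-injective)
open import Data.Nat using (ℕ; suc)
open import Data.Nat.Properties using (<-irrefl; m<1+n⇒m<n∨m≡n; m<n⇒m<1+n; n<1+n)
open import Data.Product using (Σ; _×_; _,_; proj₁; proj₂)
open import Data.Sum using (_⊎_; inj₁; inj₂)
open import Relation.Nullary using (¬_; yes; no)
open import Relation.Binary.PropositionalEquality
  using (_≡_; refl; sym; trans; cong; cong₂; subst)

module ActionProperties {c ℓ : Level} {G : Group c ℓ} {X : Set}
                        (α : RightAction G X) where
  open Group G using (_⁻¹; ε; inverseˡ; inverseʳ)
  open GroupProperties G using (ε⁻¹≈ε)
  open RightAction α

  act-cancelʳ : ∀ x g → act (act x g) (g ⁻¹) ≡ x
  act-cancelʳ x g =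
    trans (sym (act-∙ x g (g ⁻¹))) (trans (act-cong x (inverseʳ g)) (act-ε x))

  act-cancelˡ : ∀ x g → act (act x (g ⁻¹)) g ≡ x
  act-cancelˡ x g =
    trans (sym (act-∙ x (g ⁻¹) g)) (trans (act-cong x (inverseˡ g)) (act-ε x))

  act-injective : ∀ g {x y} → act x g ≡ act y g → x ≡ y
  act-injective g {x} {y} e =
    trans (sym (act-cancelʳ x g)) (trans (cong (λ z → act z (g ⁻¹)) e) (act-cancelʳ y g))

  act-transposeʳ : ∀ g {a b} → act a g ≡ b → act b (g ⁻¹) ≡ a
  act-transposeʳ g {a} e = trans (cong (λ z → act z (g ⁻¹)) (sym e)) (act-cancelʳ a g)

  act-transposeˡ : ∀ g {a b} → act a (g ⁻¹) ≡ b → act b g ≡ a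
  act-transposeˡ g {a} e = trans (cong (λ z → act z g) (sym e)) (act-cancelˡ a g)

  act-ε⁻¹ : ∀ x → act x (ε ⁻¹) ≡ x
  act-ε⁻¹ x = trans (act-cong x ε⁻¹≈ε) (act-ε x)

module OrbitCorrespondence {c ℓ : Level} (A : Setting c ℓ) where
  open Theory A
  open ActionProperties action

  ≐-refl : ∀ {P} → P ≐ P
  ≐-refl x = (λ p → p) , (λ p → p)

  ≐-sym : ∀ {P Q} → P ≐ Q → Q ≐ P
  ≐-sym h x = proj₂ (h x) , proj₁ (h x)

  ≐-trans : ∀ {P Q T} → P ≐ Q → Q ≐ T → P ≐ T
  ≐-trans h h' x = (λ p → proj₁ (h' x) (proj₁ (h x) p)) , (λ t → proj₂ (h x) (proj₂ (h' x) t))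

  infixr 2 _≐⟨_⟩_
  infix  3 _∎ˢ

  _≐⟨_⟩_ : ∀ P {Q T} → P ≐ Q → Q ≐ T → P ≐ T
  P ≐⟨ h ⟩ h' = ≐-trans h h'

  _∎ˢ : ∀ P → P ≐ P
  P ∎ˢ = ≐-refl

  _∪｛_｝ : Subset → U → Subset
  (P ∪｛ a ｝) x = P x ⊎ x ≡ a

  ∪-cong : ∀ {P Q} a → P ≐ Q → (P ∪｛ a ｝) ≐ (Q ∪｛ a ｝)
  ∪-cong a h x = (λ { (inj₁ p) → inj₁ (proj₁ (h x) p) ; (inj₂ e) → inj₂ e })
               , (λ { (inj₁ q) → inj₁ (proj₂ (h x) q) ; (inj₂ e) → inj₂ e })

  ^ˢ-cong : ∀ {P Q} g → P ≐ Q → (P ^ˢ g) ≐ (Q ^ˢ g)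
  ^ˢ-cong g h x = (λ { (y , p , e) → y , proj₁ (h y) p , e })
                , (λ { (y , q , e) → y , proj₂ (h y) q , e })

  ^ˢ-cancel : ∀ P g → ((P ^ˢ g) ^ˢ (g ⁻¹)) ≐ P
  ^ˢ-cancel P g x =
      (λ { (y , (z , p , e₁) , e₂) →
             subst P (trans (sym (act-transposeʳ g e₁)) e₂) p })
    , (λ p → act x g , (x , p , refl) , act-cancelʳ x g)

  ∪-image : ∀ {W a b g} → AutSet W g → act b g ≡ a → ((W ∪｛ b ｝) ^ˢ g) ≐ (W ∪｛ a ｝)
  ∪-image {W} {a} {b} {g} g-aut b^g≡a x = forward , backward
    where
    forward : ((W ∪｛ b ｝) ^ˢ g) x → (W ∪｛ a ｝) x
    forward (y , inj₁ Wy , e)   = inj₁ (proj₁ (g-aut x) (y , Wy , e))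
    forward (y , inj₂ refl , e) = inj₂ (trans (sym e) b^g≡a)
    backward : (W ∪｛ a ｝) x → ((W ∪｛ b ｝) ^ˢ g) x
    backward (inj₁ Wx) with proj₂ (g-aut x) Wx
    ... | y , Wy , e = y , inj₁ Wy , e
    backward (inj₂ refl) = b , inj₂ refl , b^g≡a

  aut-inverse : ∀ {W g} → AutSet W g → AutSet W (g ⁻¹)
  aut-inverse {W} {g} g-aut =
    (W ^ˢ (g ⁻¹))          ≐⟨ ^ˢ-cong (g ⁻¹) (≐-sym g-aut) ⟩
    ((W ^ˢ g) ^ˢ (g ⁻¹))   ≐⟨ ^ˢ-cancel W g ⟩
    W                      ∎ˢ

  aut-outside : ∀ {W g x} → AutSet W g → ¬ W x → ¬ W (act x g)
  aut-outside {W} {g} {x} g-aut x∉W x^g∈W with proj₂ (g-aut (act x g)) x^g∈W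
  ... | y , Wy , e = x∉W (subst W (act-injective g e) Wy)

  not-in-dom : ∀ (X : PA) x → ¬ Dom X x → X x ≡ nothing
  not-in-dom X x x∉X with X x
  ... | just r  = ⊥-elim (x∉X (r , refl))
  ... | nothing = refl

  dom-^ᵖ : ∀ X g → Dom (X ^ᵖ g) ≐ (Dom X ^ˢ g)
  dom-^ᵖ X g x = (λ d → act x (g ⁻¹) , d , act-cancelˡ x g)
               , (λ { (y , d , e) → subst (Dom X) (sym (act-transposeʳ g e)) d })

  _⊑_ : PA → PA → Set
  S ⊑ X = ∀ x r → S x ≡ just r → X x ≡ just r

  ⊑-^ᵖ : ∀ {S X} g → S ⊑ X → (S ^ᵖ g) ⊑ (X ^ᵖ g)
  ⊑-^ᵖ g S⊑X x = S⊑X (act x (g ⁻¹))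

  ⊑-^ᵖ-reflect : ∀ {S X} g → (S ^ᵖ g) ⊑ (X ^ᵖ g) → S ⊑ X
  ⊑-^ᵖ-reflect {S} {X} g h x r e =
    subst (λ y → X y ≡ just r) (act-cancelʳ x g)
      (h (act x g) r (trans (cong S (act-cancelʳ x g)) e))

  restriction-of-⊑ : ∀ {S X} → S ⊑ X → IsRestriction X (Dom S) S
  restriction-of-⊑ {S} {X} S⊑X =
      (λ { x (r , e) → r , S⊑X x r e })
    , λ x → (λ { (r , e) → trans e (sym (S⊑X x r e)) }) , not-in-dom S x

  ⊑-of-restriction : ∀ {X Q S} → IsRestriction X Q S → (∀ x → Dom S x → Q x) → S ⊑ X
  ⊑-of-restriction res dom⊆Q x r e =
    trans (sym (proj₁ (proj₂ res x) (dom⊆Q x (r , e)))) e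

  restriction-cong : ∀ {X Q Q' S} → Q ≐ Q' → IsRestriction X Q S → IsRestriction X Q' S
  restriction-cong Q≐Q' (Q⊆X , agree) =
      (λ x q → Q⊆X x (proj₂ (Q≐Q' x) q))
    , λ x → (λ q → proj₁ (agree x) (proj₂ (Q≐Q' x) q))
          , (λ q̸ → proj₂ (agree x) (λ q → q̸ (proj₁ (Q≐Q' x) q)))

  extend : PA → U → R → PA
  extend S v r x with x ≟ v
  ... | yes _ = just r
  ... | no _  = S x

  extend-at : ∀ S v r → extend S v r v ≡ just r
  extend-at S v r with v ≟ v
  ... | yes _   = refl
  ... | no v≢v = ⊥-elim (v≢v refl)

  extend-dom : ∀ S v r → Dom (extend S v r) ≐ (Dom S ∪｛ v ｝)
  extend-dom S v r x with x ≟ v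
  ... | yes x≡v = (λ _ → inj₂ x≡v) , (λ _ → r , refl)
  ... | no x≢v  = inj₁ , λ { (inj₁ d) → d ; (inj₂ x≡v) → ⊥-elim (x≢v x≡v) }

  extend-⊒ : ∀ {S v} r → ¬ Dom S v → S ⊑ extend S v r
  extend-⊒ {S} {v} r v∉S x s e with x ≟ v
  ... | yes refl = ⊥-elim (v∉S (s , e))
  ... | no _     = e

  extend-hit : ∀ {S w r x s} → ¬ Dom S x → extend S w r x ≡ just s → x ≡ w × r ≡ s
  extend-hit {S} {w} {r} {x} x∉S e with x ≟ w
  ... | yes x≡w = x≡w , just-injective e
  ... | no _    = ⊥-elim (x∉S (_ , e))

  extend-injective : ∀ {S w w' r r'} → ¬ Dom S w →
    extend S w r ≗ₚ extend S w' r' → w ≡ w' × r ≡ r'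
  extend-injective {S} {w} {w'} {r} w∉S h
    with extend-hit w∉S (trans (sym (h w)) (extend-at S w r))
  ... | w≡w' , r'≡r = w≡w' , sym r'≡r

  extend-unique : ∀ {S X w r} → S ⊑ X → Dom X ≐ (Dom S ∪｛ w ｝) → X w ≡ just r →
    X ≗ₚ extend S w r
  extend-unique {S} {X} {w} S⊑X domX Xw x with x ≟ w
  ... | yes refl = Xw
  ... | no x≢w with S x in eq
  ...   | just s  = S⊑X x s eq
  ...   | nothing = not-in-dom X x x∉X
    where
    x∉X : ¬ Dom X x
    x∉X d with proj₁ (domX x) d
    ... | inj₁ (s , e) with () ← trans (sym eq) e
    ... | inj₂ x≡w = x≢w x≡w

  extend-conj : ∀ {S σ} w r → AutPA S σ → (extend S w r ^ᵖ σ) ≗ₚ extend S (act w σ) r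
  extend-conj {S} {σ} w r σ-aut x with act x (σ ⁻¹) ≟ w | x ≟ act w σ
  ... | yes _ | yes _     = refl
  ... | yes e | no x≢w^σ = ⊥-elim (x≢w^σ (sym (act-transposeˡ σ e)))
  ... | no n  | yes e     = ⊥-elim (n (act-transposeʳ σ (sym e)))
  ... | no _  | no _      = σ-aut x

  extension-conj : ∀ {S X σ w r} → AutPA S σ → X ≗ₚ extend S w r →
    (X ^ᵖ σ) ≗ₚ extend S (act w σ) r
  extension-conj {σ = σ} {w} {r} σ-aut X≗ x =
    trans (X≗ (act x (σ ⁻¹))) (extend-conj w r σ-aut x)

  Uset-suc : ∀ i → Uset (suc (toℕ i)) ≐ (Uset (toℕ i) ∪｛ u i ｝)
  Uset-suc i x = split , join
    where
    split : Uset (suc (toℕ i)) x → (Uset (toℕ i) ∪｛ u i ｝) x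
    split (t , t<1+i , e) with m<1+n⇒m<n∨m≡n t<1+i
    ... | inj₁ t<i = inj₁ (t , t<i , e)
    ... | inj₂ t≡i = inj₂ (trans (sym e) (cong u (toℕ-injective t≡i)))
    join : (Uset (toℕ i) ∪｛ u i ｝) x → Uset (suc (toℕ i)) x
    join (inj₁ (t , t<i , e)) = t , m<n⇒m<1+n t<i , e
    join (inj₂ e)             = i , n<1+n (toℕ i) , sym e

  u∉Uset : ∀ i → ¬ Uset (toℕ i) (u i)
  u∉Uset i (t , t<i , e) with u-inj e
  ... | refl = <-irrefl refl t<i

  module Normalized-S (i : Fin k) (S : PA) (normalized : Normalized (toℕ i) S) where
    J : ℕ
    J = toℕ i

    W : Subset
    W = Uset J

    aut-S-forward : ∀ {σ} → AutPA S σ → ∀ x → S (act x σ) ≡ S x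
    aut-S-forward {σ} σ-aut x = trans (sym (σ-aut (act x σ))) (cong S (act-cancelʳ x σ))

    aut-S-ε : AutPA S ε
    aut-S-ε x = cong S (act-ε⁻¹ x)

    orbit-outside : (p : OrbU i) → ¬ Dom S (proj₁ p)
    orbit-outside (v , g , g-aut , refl) d =
      aut-outside g-aut (u∉Uset i) (proj₁ (normalized v) d)

    aut-S-outside : ∀ {σ w} → AutPA S σ → ¬ Dom S w → ¬ Dom S (act w σ)
    aut-S-outside σ-aut w∉S (s , e) = w∉S (s , trans (sym (aut-S-forward σ-aut _)) e)

    extendBy : OrbU i × R → PA
    extendBy ((v , _) , r) = extend S v r

    edge-shape : (e : eS J S) → Σ (OrbU i × R) λ p → proj₁ e ≗ₚ extendBy p
    edge-shape (X , _ , γ , domX^γ , domS^γ , res) =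
      ((w , γ ⁻¹ , aut-inverse γ-aut , refl) , proj₁ w∈X) ,
      extend-unique S⊑X domX (proj₂ w∈X)
      where
      γ-aut : AutSet W γ
      γ-aut = ≐-trans (^ˢ-cong γ (≐-sym normalized)) domS^γ
      w : U
      w = act (u i) (γ ⁻¹)
      domX : Dom X ≐ (Dom S ∪｛ w ｝)
      domX =
        Dom X                         ≐⟨ ≐-sym (^ˢ-cancel (Dom X) γ) ⟩
        ((Dom X ^ˢ γ) ^ˢ (γ ⁻¹))      ≐⟨ ^ˢ-cong (γ ⁻¹) (≐-trans domX^γ (Uset-suc i)) ⟩
        ((W ∪｛ u i ｝) ^ˢ (γ ⁻¹))    ≐⟨ ∪-image (aut-inverse γ-aut) refl ⟩
        (W ∪｛ w ｝)                  ≐⟨ ∪-cong w (≐-sym normalized) ⟩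
        (Dom S ∪｛ w ｝)              ∎ˢ
      w∈X : Dom X w
      w∈X = proj₂ (domX w) (inj₂ refl)
      S⊑X : S ⊑ X
      S⊑X = ⊑-^ᵖ-reflect γ (⊑-of-restriction res
              (λ x d → proj₁ (≐-trans (dom-^ᵖ S γ) domS^γ x) d))

    extendBy-edge : OrbU i × R → eS J S
    extendBy-edge p@((v , γ , γ-aut , u^γ≡v) , r) =
      X , (γ , domX-Ω) , γ ⁻¹ , domX^γ⁻¹ , domS^γ⁻¹ , res
      where
      X : PA
      X = extend S v r
      domX : Dom X ≐ (W ∪｛ v ｝)
      domX = ≐-trans (extend-dom S v r) (∪-cong v normalized)
      domX-Ω : Dom X ≐ (Uset (suc J) ^ˢ γ)
      domX-Ω =
        Dom X                     ≐⟨ domX ⟩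
        (W ∪｛ v ｝)              ≐⟨ ≐-sym (∪-image γ-aut u^γ≡v) ⟩
        ((W ∪｛ u i ｝) ^ˢ γ)     ≐⟨ ^ˢ-cong γ (≐-sym (Uset-suc i)) ⟩
        (Uset (suc J) ^ˢ γ)       ∎ˢ
      domX^γ⁻¹ : (Dom X ^ˢ (γ ⁻¹)) ≐ Uset (suc J)
      domX^γ⁻¹ =
        (Dom X ^ˢ (γ ⁻¹))         ≐⟨ ^ˢ-cong (γ ⁻¹) domX ⟩
        ((W ∪｛ v ｝) ^ˢ (γ ⁻¹))  ≐⟨ ∪-image (aut-inverse γ-aut) (act-transposeʳ γ u^γ≡v) ⟩
        (W ∪｛ u i ｝)            ≐⟨ ≐-sym (Uset-suc i) ⟩
        Uset (suc J)              ∎ˢ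
      domS^γ⁻¹ : (Dom S ^ˢ (γ ⁻¹)) ≐ W
      domS^γ⁻¹ = ≐-trans (^ˢ-cong (γ ⁻¹) normalized) (aut-inverse γ-aut)
      res : IsRestriction (X ^ᵖ (γ ⁻¹)) W (S ^ᵖ (γ ⁻¹))
      res = restriction-cong (≐-trans (dom-^ᵖ S (γ ⁻¹)) domS^γ⁻¹)
              (restriction-of-⊑ (⊑-^ᵖ (γ ⁻¹) (extend-⊒ r (orbit-outside (proj₁ p)))))

    orbit-data : eS J S → OrbU i × R
    orbit-data e = proj₁ (edge-shape e)

    point : eS J S → U
    point e = proj₁ (proj₁ (orbit-data e))

    value : eS J S → R
    value e = proj₂ (orbit-data e)

    shape : (e : eS J S) → proj₁ e ≗ₚ extend S (point e) (value e)
    shape e = proj₂ (edge-shape e)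

    orbit-data-respects : ∀ e₁ e₂ → SameOrbitE J S e₁ e₂ →
      SameOrbitP i S (orbit-data e₁) (orbit-data e₂)
    orbit-data-respects e₁ e₂ (σ , σ-aut , X^σ≗Y) =
      (σ , σ-aut , proj₁ same-extension) , proj₂ same-extension
      where
      same-extension : act (point e₁) σ ≡ point e₂ × value e₁ ≡ value e₂
      same-extension =
        extend-injective (aut-S-outside σ-aut (orbit-outside (proj₁ (orbit-data e₁))))
          (λ x → trans (sym (extension-conj σ-aut (shape e₁) x))
                       (trans (X^σ≗Y x) (shape e₂ x)))

    orbit-data-reflects : ∀ e₁ e₂ → SameOrbitP i S (orbit-data e₁) (orbit-data e₂) →
      SameOrbitE J S e₁ e₂
    orbit-data-reflects e₁ e₂ ((σ , σ-aut , w₁^σ≡w₂) , r₁≡r₂) =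
      σ , σ-aut , λ x →
        trans (extension-conj σ-aut (shape e₁) x)
              (trans (cong₂ (λ w r → extend S w r x) w₁^σ≡w₂ r₁≡r₂) (sym (shape e₂ x)))

    orbit-data-surjective : ∀ p → Σ (eS J S) λ e → SameOrbitP i S (orbit-data e) p
    orbit-data-surjective p@((v , _) , r) =
      e , (ε , aut-S-ε , trans (act-ε (point e)) (sym (proj₁ same-extension)))
        , sym (proj₂ same-extension)
      where
      e : eS J S
      e = extendBy-edge p
      same-extension : v ≡ point e × r ≡ value e
      same-extension = extend-injective (orbit-outside (proj₁ p)) (shape e)

lemma4p5 : {c ℓ : Level} (A : Setting c ℓ) →
    let open Theory A in
    (i : Fin k) (S : PA) → InΩ (toℕ i) S → Normalized (toℕ i) S →
      Σ (eS (toℕ i) S → OrbU i × R) λ φ →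
        InducesBijection (SameOrbitE (toℕ i) S) (SameOrbitP i S) φ
lemma4p5 A i S _ normalized =
  orbit-data , orbit-data-respects , orbit-data-reflects , orbit-data-surjective
  where open OrbitCorrespondence.Normalized-S A i S normalized
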